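{- Consider the three (marked) mesh patterns $j_1=(32451;\ \text{shaded } \emptyset;\ \text{marked } \{(1,3),(1,4),(1,5)\})$, $j_2=(34251;\ \text{shaded } \{(2,4),(2,5)\})$, $j_3=(43251;\ \text{shaded } \{(1,4),(1,5),(2,4),(2,5)\};\ \text{marked } \{(2,3)\})$. Let $\pi$ be a permutation. (i) For each $k\in\{1,2,3\}$ and each occurrence of $j_k$ in $\pi$, the four entries of $\pi$ playing the roles of the pattern values $1,2,3,4$ form an occurrence of the classical pattern $3241$ in $S(\pi)$. (ii) Conversely, for every occurrence of $3241$ in $S(\pi)$, with set of entries $E$, there is exactly one $k\in\{1,2,3\}$ such that $E$, together with some further entry of $\pi$, forms an occurrence of $j_k$ in $\pi$ in which the entries of $E$ play the roles of the pattern values $1,2,3,4$.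
   Context: Permutations are written in one-line notation. The stack-sort operator $S$ is defined by $S(\varepsilon)=\varepsilon$ and, if $\pi=\alpha\, m\,\beta$ with $m$ the largest entry, $S(\pi)=S(\alpha)S(\beta)m$. An occurrence of a classical pattern $p\in S_k$ in $\pi\in S_n$ is a sequence of indices $i_1<\dots<i_k$ with $\pi(i_a)<\pi(i_b)\iff p(a)<p(b)$; the entry $\pi(i_a)$ plays the role of the pattern value $p(a)$. For an occurrence put $i_0=0$, $i_{k+1}=n+1$, let $v_0=0$, $v_1<\dots<v_k$ the occurrence values sorted, $v_{k+1}=n+1$; box $(a,b)\in\{0,\dots,k\}^2$ corresponds to the entries $\pi(t)$ with $i_a<t<i_{a+1}$ and $v_b<\pi(t)<v_{b+1}$. In the notation $(p;\ \text{shaded } R;\ \text{marked } M)$, an occurrence of the pattern is an occurrence of $p$ such that every box in $R$ corresponds to the empty set and the union of the entries corresponding to the boxes in $M$ contains at least one entry. -}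

module Defs where

open import Data.Nat using (ℕ; zero; suc; _≤_; _<_; _⊔_; _≟_; _≡ᵇ_)
open import Data.Bool using (if_then_else_)
open import Data.List using (List; []; _∷_; _++_; length; map; foldr; span; upTo)
open import Data.List.Relation.Unary.All using (All)
open import Data.List.Relation.Unary.Any using (Any)
open import Data.List.Relation.Binary.Permutation.Propositional using (_↭_)
open import Data.Product using (_×_; _,_; ∃; ∃-syntax; ∃!)
open import Data.Fin using (Fin)
open import Data.Unit using (⊤)
open import Function.Bundles using (_⇔_)
open import Relation.Nullary using (¬_; ¬?)
open import Relation.Binary.PropositionalEquality using (_≡_)

-- Permutations in one-line notation, as lists of naturals.

IsPerm : List ℕ → Set
IsPerm π = π ↭ map suc (upTo (length π))

-- 1-based access: at π t = π(t) for 1 ≤ t ≤ length π, and 0 otherwise.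
at : List ℕ → ℕ → ℕ
at []       _             = 0
at (x ∷ xs) zero          = 0
at (x ∷ xs) (suc zero)    = x
at (x ∷ xs) (suc (suc t)) = at xs (suc t)

-- Stack sort: S(ε) = ε, S(α m β) = S(α) S(β) m with m the largest entry.
-- Implemented by recursion on a fuel parameter; fuel = length suffices
-- since α and β are strictly shorter.

maxL : List ℕ → ℕ
maxL = foldr _⊔_ 0

S-fuel : ℕ → List ℕ → List ℕ
S-fuel zero    _ = []
S-fuel (suc f) π with span (λ y → ¬? (y ≟ maxL π)) π
... | (α , [])    = S-fuel f α
... | (α , m ∷ β) = S-fuel f α ++ S-fuel f β ++ (m ∷ [])

S : List ℕ → List ℕ
S π = S-fuel (length π) π

-- Classical pattern occurrences.  A pattern p ∈ S_k is a list; an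
-- occurrence is a list idx = [i₁,…,i_k] of positions (1-based).

Occ : List ℕ → List ℕ → List ℕ → Set
Occ p π idx =
  length idx ≡ length p
  × (∀ a → 1 ≤ a → suc a ≤ length idx → at idx a < at idx (suc a))
  × (∀ a → 1 ≤ a → a ≤ length idx → 1 ≤ at idx a × at idx a ≤ length π)
  × (∀ a b → 1 ≤ a → a ≤ length idx → 1 ≤ b → b ≤ length idx →
       (at π (at idx a) < at π (at idx b) ⇔ at p a < at p b))

-- position (1-based) of value c in p (0 if absent)
posOf : List ℕ → ℕ → ℕ
posOf []       c = 0
posOf (x ∷ xs) c =
  if x ≡ᵇ c then 1 else (if posOf xs c ≡ᵇ 0 then 0 else suc (posOf xs c))

-- i_0 = 0, i_1 … i_k, i_{k+1} = n+1
I : List ℕ → List ℕ → ℕ → ℕ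
I π idx a = at (0 ∷ (idx ++ (suc (length π) ∷ []))) (suc a)

role : List ℕ → List ℕ → List ℕ → ℕ → ℕ
role p π idx c = at π (at idx (posOf p c))

-- v_0 = 0, v_1 < … < v_k the occurrence values sorted, v_{k+1} = n+1
-- (v_c is the entry playing the role of pattern value c)
V : List ℕ → List ℕ → List ℕ → ℕ → ℕ
V p π idx b =
  at (0 ∷ (map (role p π idx) (map suc (upTo (length p))) ++ (suc (length π) ∷ [])))
     (suc b)

InBox : List ℕ → List ℕ → List ℕ → ℕ × ℕ → ℕ → Set
InBox p π idx (a , b) t =
  1 ≤ t × t ≤ length π
  × I π idx a < t × t < I π idx (suc a)
  × V p π idx b < at π t × at π t < V p π idx (suc b)

-- (Marked) mesh patterns (p ; shaded R ; marked M).  An empty marked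
-- list means no marking condition.

record MeshPattern : Set where
  constructor mesh
  field
    pat    : List ℕ
    shaded : List (ℕ × ℕ)
    marked : List (ℕ × ℕ)

MarkedOK : List ℕ → List ℕ → List ℕ → List (ℕ × ℕ) → Set
MarkedOK p π idx []       = ⊤
MarkedOK p π idx (m ∷ ms) = Any (λ box → ∃[ t ] InBox p π idx box t) (m ∷ ms)

MeshOcc : MeshPattern → List ℕ → List ℕ → Set
MeshOcc (mesh p R M) π idx =
  Occ p π idx
  × All (λ box → ∀ t → ¬ InBox p π idx box t) R
  × MarkedOK p π idx M

j : Fin 3 → MeshPattern
j Fin.zero =
  mesh (3 ∷ 2 ∷ 4 ∷ 5 ∷ 1 ∷ []) [] ((1 , 3) ∷ (1 , 4) ∷ (1 , 5) ∷ [])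
j (Fin.suc Fin.zero) =
  mesh (3 ∷ 4 ∷ 2 ∷ 5 ∷ 1 ∷ []) ((2 , 4) ∷ (2 , 5) ∷ []) []
j (Fin.suc (Fin.suc Fin.zero)) =
  mesh (4 ∷ 3 ∷ 2 ∷ 5 ∷ 1 ∷ [])
       ((1 , 4) ∷ (1 , 5) ∷ (2 , 4) ∷ (2 , 5) ∷ []) ((2 , 3) ∷ [])

p3241 : List ℕ
p3241 = 3 ∷ 2 ∷ 4 ∷ 1 ∷ []

roles1234 : MeshPattern → List ℕ → List ℕ → List ℕ
roles1234 (mesh p R M) π idx = map (role p π idx) (1 ∷ 2 ∷ 3 ∷ 4 ∷ [])

entries : List ℕ → List ℕ → List ℕ
entries π idx = map (at π) idx

module Submission where

-- By the classical description of stack sorting, for x < y the entry y precedes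
-- x in S(π) iff in π the entry y precedes x with some entry larger than y in
-- between ("y is separated from x").  So values a < b < c < d appear in the
-- order c, b, d, a in S(π) iff, in π, c is separated from b, d is separated from
-- a, and d is not separated from b.  Each of j₁, j₂, j₃ forces exactly these
-- three conditions on its entries 1, 2, 3, 4.  Conversely, given them, the entry
-- separating d from a serves as entry 5, and the position of d relative to c and
-- b (after b, between c and b, before c) selects j₁, j₂ or j₃; the shadings say
-- precisely that d is not separated from b, and the markings come from the
-- entry separating c from b.

open import Defs
open import Data.Bool using (T; true; false)
open import Data.Empty using (⊥; ⊥-elim)
open import Data.Fin using (Fin)
open import Data.Fin.Patterns using (0F; 1F; 2F)
open import Data.Nat using (ℕ; zero; suc; _≤_; _<_; _+_; _≟_; _≡ᵇ_; _≤ᵇ_; _<ᵇ_; _⊔_; z≤n; s≤s)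
open import Data.Nat.Properties
open import Data.Product using (_×_; _,_; ∃-syntax; ∃!)
open import Data.Sum using (_⊎_; inj₁; inj₂)
open import Data.Unit using (tt)
open import Function using (case_of_)
open import Function.Bundles using (_⇔_; mk⇔; Equivalence)
open import Relation.Binary using (tri<; tri≈; tri>)
open import Relation.Binary.PropositionalEquality
  using (_≡_; _≢_; setoid; refl; sym; trans; cong; subst; subst₂; module ≡-Reasoning)
open import Relation.Nullary using (¬_; ¬?; Dec)

open import Data.List using (List; []; _∷_; _++_; length; map; span; takeWhile; dropWhile)
open import Data.List.Properties using (length-++; ++-identityʳ; takeWhile++dropWhile; span-defn)
open import Data.List.Membership.Propositional using (_∈_)
open import Data.List.Membership.Propositional.Properties
  using (∈-++⁻; ∈-++⁺ˡ; ∈-++⁺ʳ; ∈-map⁻; ∈-upTo⁻)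
open import Data.List.Relation.Binary.Equality.Propositional using (≋⇒≡)
open import Data.List.Relation.Binary.Permutation.Propositional
  using (_↭_; ↭-refl; ↭-sym; ↭-trans; ↭-prep; ↭-swap; ↭⇒↭ₛ; module PermutationReasoning)
open import Data.List.Relation.Binary.Permutation.Propositional.Properties
  using (++⁺; ++⁺ˡ; ++-comm; ∈-resp-↭)
open import Data.List.Relation.Binary.Permutation.Setoid.Properties (setoid ℕ)
  using (Unique-resp-↭)
open import Data.List.Relation.Unary.All as All using (All; []; _∷_)
open import Data.List.Relation.Unary.All.Properties using (all-takeWhile)
open import Data.List.Relation.Unary.AllPairs using ([]; _∷_)
open import Data.List.Relation.Unary.Any using (here; there)
open import Data.List.Relation.Unary.Linked as Linked using (Linked; []; [-]; _∷_)
open import Data.List.Relation.Unary.Sorted.TotalOrder.Properties using (↗↭↗⇒≋)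
open import Data.List.Relation.Unary.Unique.Propositional using (Unique)
import Data.List.Relation.Unary.Unique.Propositional.Properties as Unique

InRange : List ℕ → ℕ → Set
InRange L i = 1 ≤ i × i ≤ length L

at-∈ : ∀ L {i} → InRange L i → at L i ∈ L
at-∈ (x ∷ L) {suc zero}    _             = here refl
at-∈ (x ∷ L) {suc (suc i)} (_ , s≤s i≤n) = there (at-∈ L (s≤s z≤n , i≤n))

∈⇒at : ∀ {L x} → x ∈ L → ∃[ i ] (InRange L i × at L i ≡ x)
∈⇒at (here refl) = 1 , (s≤s z≤n , s≤s z≤n) , refl
∈⇒at (there x∈L) with ∈⇒at x∈L
... | suc i , (_ , i≤n) , eq = suc (suc i) , (s≤s z≤n , s≤s i≤n) , eq

at-injective : ∀ {L} → Unique L → ∀ {i j} → InRange L i → InRange L j →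
               at L i ≡ at L j → i ≡ j
at-injective {x ∷ L} _ {suc zero} {suc zero} _ _ _ = refl
at-injective {x ∷ L} (x∉L ∷ _) {suc zero} {suc (suc j)} _ (_ , s≤s j≤n) eq =
  ⊥-elim (All.lookup x∉L (at-∈ L (s≤s z≤n , j≤n)) eq)
at-injective {x ∷ L} (x∉L ∷ _) {suc (suc i)} {suc zero} (_ , s≤s i≤n) _ eq =
  ⊥-elim (All.lookup x∉L (at-∈ L (s≤s z≤n , i≤n)) (sym eq))
at-injective {x ∷ L} (_ ∷ u) {suc (suc i)} {suc (suc j)} (_ , s≤s i≤n) (_ , s≤s j≤n) eq =
  cong suc (at-injective u (s≤s z≤n , i≤n) (s≤s z≤n , j≤n) eq)

at-map : ∀ (f : ℕ → ℕ) L {i} → InRange L i → at (map f L) i ≡ f (at L i)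
at-map f (x ∷ L) {suc zero}    _             = refl
at-map f (x ∷ L) {suc (suc i)} (_ , s≤s i≤n) = at-map f L (s≤s z≤n , i≤n)

All-at : ∀ {P : ℕ → Set} {L} → All P L → ∀ {i} → InRange L i → P (at L i)
All-at (px ∷ _)  {suc zero}    _             = px
All-at (_ ∷ pxs) {suc (suc i)} (_ , s≤s i≤n) = All-at pxs (s≤s z≤n , i≤n)

steps⇒< : ∀ (f : ℕ → ℕ) {n} → (∀ a → 1 ≤ a → suc a ≤ n → f a < f (suc a)) →
          ∀ {a b} → 1 ≤ a → a < b → b ≤ n → f a < f b
steps⇒< f step {a} {suc b} 1≤a (s≤s a≤b) 1+b≤n with m≤n⇒m<n∨m≡n a≤b
... | inj₁ a<b  = <-trans (steps⇒< f step 1≤a a<b (<⇒≤ 1+b≤n)) (step b (≤-trans 1≤a a≤b) 1+b≤n)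
... | inj₂ refl = step a 1≤a 1+b≤n

at-strictMono : ∀ {L} → Linked _<_ L → ∀ {i j} → 1 ≤ i → i < j → j ≤ length L →
                at L i < at L j
at-strictMono {x ∷ L} _ {suc zero} {suc zero} _ (s≤s ()) _
at-strictMono {x ∷ []} [-] {suc zero} {suc (suc j)} _ _ (s≤s ())
at-strictMono {x ∷ y ∷ L} (x<y ∷ _) {suc zero} {suc (suc zero)} _ _ _ = x<y
at-strictMono {x ∷ y ∷ L} (x<y ∷ ys↗) {suc zero} {suc (suc (suc j))} _ _ (s≤s j≤n) =
  <-trans x<y (at-strictMono ys↗ (s≤s z≤n) (s≤s (s≤s z≤n)) j≤n)
at-strictMono {x ∷ y ∷ L} (_ ∷ ys↗) {suc (suc i)} {suc (suc j)} _ (s≤s i<j) (s≤s j≤n) =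
  at-strictMono ys↗ (s≤s z≤n) i<j j≤n

at-<⇔ : ∀ {L} → Linked _<_ L → ∀ {i j} → InRange L i → InRange L j →
        at L i < at L j ⇔ i < j
at-<⇔ {L} L↗ {i} {j} (1≤i , i≤n) (1≤j , j≤n) = mk⇔ to (λ i<j → at-strictMono L↗ 1≤i i<j j≤n)
  where
  to : at L i < at L j → i < j
  to Li<Lj with <-cmp i j
  ... | tri< i<j _ _ = i<j
  ... | tri≈ _ refl _ = ⊥-elim (<-irrefl refl Li<Lj)
  ... | tri> _ _ j<i = ⊥-elim (<-asym Li<Lj (at-strictMono L↗ 1≤j j<i i≤n))

data Before : List ℕ → ℕ → ℕ → Set where
  here  : ∀ {x y L}   → y ∈ L → Before (x ∷ L) x y
  there : ∀ {x y z L} → Before L x y → Before (z ∷ L) x y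

data Separated : List ℕ → ℕ → ℕ → Set where
  here  : ∀ {y x z L} → y < z → Before L z x → Separated (y ∷ L) y x
  there : ∀ {y x w L} → Separated L y x → Separated (w ∷ L) y x

before-∈ˡ : ∀ {L x y} → Before L x y → x ∈ L
before-∈ˡ (here _)  = here refl
before-∈ˡ (there b) = there (before-∈ˡ b)

before-∈ʳ : ∀ {L x y} → Before L x y → y ∈ L
before-∈ʳ (here y∈L) = there y∈L
before-∈ʳ (there b)  = there (before-∈ʳ b)

separated-∈ˡ : ∀ {L y x} → Separated L y x → y ∈ L
separated-∈ˡ (here _ _) = here refl
separated-∈ˡ (there s)  = there (separated-∈ˡ s)

separated-∈ʳ : ∀ {L y x} → Separated L y x → x ∈ L
separated-∈ʳ (here _ b) = there (before-∈ʳ b)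
separated-∈ʳ (there s)  = there (separated-∈ʳ s)

before-++⁺ˡ : ∀ {A B x y} → Before A x y → Before (A ++ B) x y
before-++⁺ˡ (here y∈A) = here (∈-++⁺ˡ y∈A)
before-++⁺ˡ (there b)  = there (before-++⁺ˡ b)

before-++⁺ʳ : ∀ A {B x y} → Before B x y → Before (A ++ B) x y
before-++⁺ʳ []      b = b
before-++⁺ʳ (_ ∷ A) b = there (before-++⁺ʳ A b)

before-++⁺ : ∀ {A B x y} → x ∈ A → y ∈ B → Before (A ++ B) x y
before-++⁺ {_ ∷ A} (here refl) y∈B = here (∈-++⁺ʳ A y∈B)
before-++⁺         (there x∈A) y∈B = there (before-++⁺ x∈A y∈B)

before-++⁻ : ∀ A {B x y} → Before (A ++ B) x y →
             Before A x y ⊎ Before B x y ⊎ (x ∈ A × y ∈ B)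
before-++⁻ []      b = inj₂ (inj₁ b)
before-++⁻ (_ ∷ A) (here y∈A++B) with ∈-++⁻ A y∈A++B
... | inj₁ y∈A = inj₁ (here y∈A)
... | inj₂ y∈B = inj₂ (inj₂ (here refl , y∈B))
before-++⁻ (_ ∷ A) (there b) with before-++⁻ A b
... | inj₁ b′              = inj₁ (there b′)
... | inj₂ (inj₁ b′)       = inj₂ (inj₁ b′)
... | inj₂ (inj₂ (x∈A , y∈B)) = inj₂ (inj₂ (there x∈A , y∈B))

before-total : ∀ {L x y} → x ∈ L → y ∈ L → x ≢ y → Before L x y ⊎ Before L y x
before-total (here refl) (here refl) x≢y = ⊥-elim (x≢y refl)
before-total (here refl) (there y∈L) _   = inj₁ (here y∈L)
before-total (there x∈L) (here refl) _   = inj₂ (here x∈L)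
before-total (there x∈L) (there y∈L) x≢y with before-total x∈L y∈L x≢y
... | inj₁ b = inj₁ (there b)
... | inj₂ b = inj₂ (there b)

before-asym : ∀ {L x y} → Unique L → Before L x y → ¬ Before L y x
before-asym (x∉L ∷ _) (here y∈L) (here x∈L) = All.lookup x∉L x∈L refl
before-asym (x∉L ∷ _) (here _)   (there b)  = All.lookup x∉L (before-∈ʳ b) refl
before-asym (y∉L ∷ _) (there b)  (here _)   = All.lookup y∉L (before-∈ʳ b) refl
before-asym (_ ∷ u)   (there b)  (there b′) = before-asym u b b′

separated-++⁺ˡ : ∀ {A B y x} → Separated A y x → Separated (A ++ B) y x
separated-++⁺ˡ (here y<z b) = here y<z (before-++⁺ˡ b)
separated-++⁺ˡ (there s)    = there (separated-++⁺ˡ s)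

separated-++⁺ʳ : ∀ A {B y x} → Separated B y x → Separated (A ++ B) y x
separated-++⁺ʳ []      s = s
separated-++⁺ʳ (_ ∷ A) s = there (separated-++⁺ʳ A s)

separated-++⁺ : ∀ {A B y z x} → y ∈ A → y < z → x ∈ B → Separated (A ++ z ∷ B) y x
separated-++⁺ {_ ∷ A} (here refl) y<z x∈B = here y<z (before-++⁺ʳ A (here x∈B))
separated-++⁺         (there y∈A) y<z x∈B = there (separated-++⁺ y∈A y<z x∈B)

separated-++⁻ : ∀ A {B y x} → Separated (A ++ B) y x →
                Separated A y x ⊎ Separated B y x ⊎ (y ∈ A × x ∈ B)
separated-++⁻ []      s = inj₂ (inj₁ s)
separated-++⁻ (_ ∷ A) (here y<z b) with before-++⁻ A b
... | inj₁ b′              = inj₁ (here y<z b′)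
... | inj₂ (inj₁ b′)       = inj₂ (inj₂ (here refl , before-∈ʳ b′))
... | inj₂ (inj₂ (_ , x∈B)) = inj₂ (inj₂ (here refl , x∈B))
separated-++⁻ (_ ∷ A) (there s) with separated-++⁻ A s
... | inj₁ s′                 = inj₁ (there s′)
... | inj₂ (inj₁ s′)          = inj₂ (inj₁ s′)
... | inj₂ (inj₂ (y∈A , x∈B)) = inj₂ (inj₂ (there y∈A , x∈B))

before⇒at : ∀ {L x y} → Before L x y →
            ∃[ i ] ∃[ j ] (1 ≤ i × i < j × j ≤ length L × at L i ≡ x × at L j ≡ y)
before⇒at (here y∈L) with ∈⇒at y∈L
... | suc j , (_ , j≤n) , eq = 1 , suc (suc j) , s≤s z≤n , s≤s (s≤s z≤n) , s≤s j≤n , refl , eq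
before⇒at (there b) with before⇒at b
... | suc i , suc j , _ , i<j , j≤n , eqˣ , eqʸ =
  suc (suc i) , suc (suc j) , s≤s z≤n , s≤s i<j , s≤s j≤n , eqˣ , eqʸ

at⇒before : ∀ L {i j} → InRange L i → i < j → InRange L j → Before L (at L i) (at L j)
at⇒before (x ∷ L) {suc zero} {suc zero} _ (s≤s ()) _
at⇒before (x ∷ L) {suc zero} {suc (suc j)} _ _ (_ , s≤s j≤n) = here (at-∈ L (s≤s z≤n , j≤n))
at⇒before (x ∷ L) {suc (suc i)} {suc (suc j)} (_ , s≤s i≤n) (s≤s i<j) (_ , s≤s j≤n) =
  there (at⇒before L (s≤s z≤n , i≤n) i<j (s≤s z≤n , j≤n))

before⇒< : ∀ {L x y} → Unique L → Before L x y → ∀ {i j} → InRange L i → at L i ≡ x →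
           InRange L j → at L j ≡ y → i < j
before⇒< u b {i} {j} i∈ refl j∈ refl with before⇒at b
... | i′ , j′ , 1≤i′ , i′<j′ , j′≤n , eqⁱ , eqʲ =
  subst₂ _<_ (at-injective u (1≤i′ , <⇒≤ (<-≤-trans i′<j′ j′≤n)) i∈ eqⁱ)
             (at-injective u (<-≤-trans (s≤s z≤n) i′<j′ , j′≤n) j∈ eqʲ) i′<j′

separated⇒at : ∀ {L y x} → Separated L y x →
  ∃[ i ] ∃[ k ] ∃[ j ] (1 ≤ i × i < k × k < j × j ≤ length L
                        × at L i ≡ y × y < at L k × at L j ≡ x)
separated⇒at (here y<z b) with before⇒at b
... | suc k , suc j , _ , k<j , j≤n , refl , eqˣ =
  1 , suc (suc k) , suc (suc j) , s≤s z≤n , s≤s (s≤s z≤n) , s≤s k<j , s≤s j≤n , refl , y<z , eqˣ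
separated⇒at (there s) with separated⇒at s
... | suc i , suc k , suc j , _ , i<k , k<j , j≤n , eqʸ , y<Lk , eqˣ =
  suc (suc i) , suc (suc k) , suc (suc j) , s≤s z≤n , s≤s i<k , s≤s k<j , s≤s j≤n , eqʸ , y<Lk , eqˣ

at⇒separated : ∀ L {i k j} → InRange L i → i < k → k < j → InRange L j →
               at L i < at L k → Separated L (at L i) (at L j)
at⇒separated (x ∷ L) {suc zero} {suc zero} _ (s≤s ()) _ _ _
at⇒separated (x ∷ L) {suc zero} {suc (suc k)} {suc (suc j)} _ _ (s≤s k<j) (_ , s≤s j≤n) x<Lk =
  here x<Lk (at⇒before L (s≤s z≤n , <⇒≤ (<-≤-trans k<j j≤n)) k<j (s≤s z≤n , j≤n))
at⇒separated (x ∷ L) {suc (suc i)} {suc (suc k)} {suc (suc j)}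
             (_ , s≤s i≤n) (s≤s i<k) (s≤s k<j) (_ , s≤s j≤n) Li<Lk =
  there (at⇒separated L (s≤s z≤n , i≤n) i<k k<j (s≤s z≤n , j≤n) Li<Lk)

separated⇒between : ∀ {L} → Unique L → ∀ {i j} → InRange L i → InRange L j →
                    Separated L (at L i) (at L j) →
                    ∃[ k ] (InRange L k × i < k × k < j × at L i < at L k)
separated⇒between u i∈ j∈ s with separated⇒at s
... | i′ , k , j′ , 1≤i′ , i′<k , k<j′ , j′≤n , eqⁱ , Li<Lk , eqʲ
  with at-injective u (1≤i′ , <⇒≤ (<-trans i′<k (<-≤-trans k<j′ j′≤n))) i∈ eqⁱ
     | at-injective u (<-≤-trans (s≤s z≤n) (<-trans i′<k k<j′) , j′≤n) j∈ eqʲ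
... | refl | refl =
  k , (<-≤-trans (s≤s z≤n) i′<k , <⇒≤ (<-≤-trans k<j′ j′≤n)) , i′<k , k<j′ , Li<Lk

-- Stack sorting

maxL-upper : ∀ {z} L → z ∈ L → z ≤ maxL L
maxL-upper (x ∷ L) (here refl) = m≤m⊔n x (maxL L)
maxL-upper (x ∷ L) (there z∈L) = ≤-trans (maxL-upper L z∈L) (m≤n⊔m x (maxL L))

maxL-∈ : ∀ x L → maxL (x ∷ L) ∈ x ∷ L
maxL-∈ x []      rewrite ⊔-identityʳ x = here refl
maxL-∈ x (y ∷ L) with ⊔-sel x (maxL (y ∷ L))
... | inj₁ eq rewrite eq = here refl
... | inj₂ eq rewrite eq = there (maxL-∈ y L)

dropWhile-≢-head : ∀ m L {y ys} → dropWhile (λ z → ¬? (z ≟ m)) L ≡ y ∷ ys → y ≡ m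
dropWhile-≢-head m (x ∷ L) eq with x ≡ᵇ m in x≡ᵇm
dropWhile-≢-head m (x ∷ L) refl | true  = ≡ᵇ⇒≡ x m (subst T (sym x≡ᵇm) tt)
dropWhile-≢-head m (x ∷ L) eq   | false = dropWhile-≢-head m L eq

record MaxSplit (f : ℕ) (L : List ℕ) : Set where
  field
    α β    : List ℕ
    m      : ℕ
    L≡     : L ≡ α ++ m ∷ β
    α<m    : ∀ {z} → z ∈ α → z < m
    β≤m    : ∀ {z} → z ∈ β → z ≤ m
    |α|≤f  : length α ≤ f
    |β|≤f  : length β ≤ f
    S-step : S-fuel (suc f) L ≡ S-fuel f α ++ S-fuel f β ++ m ∷ []

maxSplit : ∀ f x xs → length (x ∷ xs) ≤ suc f → MaxSplit f (x ∷ xs)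
maxSplit f x xs |L|≤1+f =
  split (takeWhile P? L) (dropWhile P? L) (takeWhile++dropWhile P? L)
        (all-takeWhile P? L) (span-defn P? L) (dropWhile-≢-head (maxL L) L)
  where
  L : List ℕ
  L = x ∷ xs
  P? : ∀ y → Dec (y ≢ maxL L)
  P? = λ y → ¬? (y ≟ maxL L)
  split : ∀ α r → α ++ r ≡ L → All (_≢ maxL L) α → span P? L ≡ (α , r) →
          (∀ {y ys} → r ≡ y ∷ ys → y ≡ maxL L) → MaxSplit f L
  split α [] α++[]≡L α≢m _ _ =
    ⊥-elim (All.lookup α≢m (subst (maxL L ∈_) (trans (sym α++[]≡L) (++-identityʳ α)) (maxL-∈ x xs))
                       refl)
  split α (m ∷ β) α++m∷β≡L α≢m span≡ head≡ with head≡ refl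
  ... | refl = record
    { α = α ; β = β ; m = m ; L≡ = sym α++m∷β≡L
    ; α<m = λ z∈α → ≤∧≢⇒< (upper (∈-++⁺ˡ z∈α)) (All.lookup α≢m z∈α)
    ; β≤m = λ z∈β → upper (∈-++⁺ʳ α (there z∈β))
    ; |α|≤f = m+n≤o⇒m≤o (length α) lengths
    ; |β|≤f = m+n≤o⇒n≤o (length α) lengths
    ; S-step = step span≡ }
    where
    upper : ∀ {z} → z ∈ α ++ m ∷ β → z ≤ m
    upper z∈ = maxL-upper L (subst (_ ∈_) α++m∷β≡L z∈)
    lengths : length α + length β ≤ f
    lengths = ≤-pred (begin
      suc (length α + length β) ≡⟨ sym (+-suc (length α) (length β)) ⟩
      length α + length (m ∷ β) ≡⟨ sym (length-++ α) ⟩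
      length (α ++ m ∷ β)       ≡⟨ cong length α++m∷β≡L ⟩
      length L                  ≤⟨ |L|≤1+f ⟩
      suc f                     ∎)
      where open ≤-Reasoning
    step : span P? L ≡ (α , m ∷ β) → S-fuel (suc f) L ≡ S-fuel f α ++ S-fuel f β ++ m ∷ []
    step eq rewrite eq = refl

S-fuel-[] : ∀ f → S-fuel f [] ≡ []
S-fuel-[] zero    = refl
S-fuel-[] (suc f) = S-fuel-[] f

S-fuel-↭ : ∀ f L → length L ≤ f → S-fuel f L ↭ L
S-fuel-↭ zero    []       _ = ↭-refl
S-fuel-↭ (suc f) []       _ rewrite S-fuel-[] f = ↭-refl
S-fuel-↭ (suc f) (x ∷ xs) |L|≤1+f = begin
  S-fuel (suc f) (x ∷ xs)            ≡⟨ S-step ⟩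
  S-fuel f α ++ S-fuel f β ++ m ∷ [] ↭⟨ ++⁺ˡ (S-fuel f α) (++-comm (S-fuel f β) (m ∷ [])) ⟩
  S-fuel f α ++ m ∷ S-fuel f β       ↭⟨ ++⁺ (S-fuel-↭ f α |α|≤f) (↭-prep m (S-fuel-↭ f β |β|≤f)) ⟩
  α ++ m ∷ β                         ≡⟨ L≡ ⟨
  x ∷ xs                             ∎
  where
  open MaxSplit (maxSplit f x xs |L|≤1+f)
  open PermutationReasoning

-- The entry larger than y lying between y and x forces y off the stack before
-- x is pushed.
before-S-fuel⇒separated : ∀ f L {x y} → length L ≤ f → x < y →
                          Before (S-fuel f L) y x → Separated L y x
before-S-fuel⇒separated zero L _ _ ()
before-S-fuel⇒separated (suc f) [] _ _ b rewrite S-fuel-[] f with b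
... | ()
before-S-fuel⇒separated (suc f) (u ∷ us) {x} {y} |L|≤1+f x<y b =
  subst (λ L → Separated L y x) (sym L≡) (split (subst (λ L → Before L y x) S-step b))
  where
  open MaxSplit (maxSplit f u us |L|≤1+f)
  ∈α : ∀ {z} → z ∈ S-fuel f α → z ∈ α
  ∈α = ∈-resp-↭ (S-fuel-↭ f α |α|≤f)
  ∈β : ∀ {z} → z ∈ S-fuel f β → z ∈ β
  ∈β = ∈-resp-↭ (S-fuel-↭ f β |β|≤f)
  split : Before (S-fuel f α ++ S-fuel f β ++ m ∷ []) y x → Separated (α ++ m ∷ β) y x
  split b with before-++⁻ (S-fuel f α) b
  ... | inj₁ bα = separated-++⁺ˡ (before-S-fuel⇒separated f α |α|≤f x<y bα)
  ... | inj₂ (inj₂ (y∈α , x∈βm)) with ∈-++⁻ (S-fuel f β) x∈βm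
  ...   | inj₁ x∈β       = separated-++⁺ (∈α y∈α) (α<m (∈α y∈α)) (∈β x∈β)
  ...   | inj₂ (here refl) = ⊥-elim (<-asym x<y (α<m (∈α y∈α)))
  split b | inj₂ (inj₁ bβm) with before-++⁻ (S-fuel f β) bβm
  ...   | inj₁ bβ = separated-++⁺ʳ α (there (before-S-fuel⇒separated f β |β|≤f x<y bβ))
  ...   | inj₂ (inj₁ (here ()))
  ...   | inj₂ (inj₁ (there ()))
  ...   | inj₂ (inj₂ (y∈β , here refl)) = ⊥-elim (<⇒≱ x<y (β≤m (∈β y∈β)))

separated⇒before-S-fuel : ∀ f L {x y} → length L ≤ f → x < y →
                          Separated L y x → Before (S-fuel f L) y x
separated⇒before-S-fuel (suc f) (u ∷ us) {x} {y} |L|≤1+f x<y s =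
  subst (λ L → Before L y x) (sym S-step) (split (subst (λ L → Separated L y x) L≡ s))
  where
  open MaxSplit (maxSplit f u us |L|≤1+f)
  ∈Sα : ∀ {z} → z ∈ α → z ∈ S-fuel f α
  ∈Sα = ∈-resp-↭ (↭-sym (S-fuel-↭ f α |α|≤f))
  ∈Sβ : ∀ {z} → z ∈ β → z ∈ S-fuel f β
  ∈Sβ = ∈-resp-↭ (↭-sym (S-fuel-↭ f β |β|≤f))
  split : Separated (α ++ m ∷ β) y x → Before (S-fuel f α ++ S-fuel f β ++ m ∷ []) y x
  split s with separated-++⁻ α s
  ... | inj₁ sα = before-++⁺ˡ (separated⇒before-S-fuel f α |α|≤f x<y sα)
  ... | inj₂ (inj₁ (here m<z bβ)) = ⊥-elim (<⇒≱ m<z (β≤m (before-∈ˡ bβ)))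
  ... | inj₂ (inj₁ (there sβ)) =
    before-++⁺ʳ (S-fuel f α) (before-++⁺ˡ (separated⇒before-S-fuel f β |β|≤f x<y sβ))
  ... | inj₂ (inj₂ (y∈α , here refl)) = ⊥-elim (<-asym x<y (α<m y∈α))
  ... | inj₂ (inj₂ (y∈α , there x∈β)) = before-++⁺ (∈Sα y∈α) (∈-++⁺ˡ (∈Sβ x∈β))

S-↭ : ∀ π → S π ↭ π
S-↭ π = S-fuel-↭ (length π) π ≤-refl

before-S⇒separated : ∀ π {x y} → x < y → Before (S π) y x → Separated π y x
before-S⇒separated π = before-S-fuel⇒separated (length π) π ≤-refl

separated⇒before-S : ∀ π {x y} → x < y → Separated π y x → Before (S π) y x
separated⇒before-S π = separated⇒before-S-fuel (length π) π ≤-refl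

¬separated⇒before-S : ∀ π {x y} → x ∈ π → y ∈ π → x < y →
                      ¬ Separated π y x → Before (S π) x y
¬separated⇒before-S π x∈π y∈π x<y ¬sep
  with before-total (∈-resp-↭ (↭-sym (S-↭ π)) x∈π) (∈-resp-↭ (↭-sym (S-↭ π)) y∈π) (<⇒≢ x<y)
... | inj₁ b = b
... | inj₂ b = ⊥-elim (¬sep (before-S⇒separated π x<y b))

IsPerm⇒Unique : ∀ {π} → IsPerm π → Unique π
IsPerm⇒Unique {π} π↭ =
  Unique-resp-↭ (↭⇒↭ₛ (↭-sym π↭)) (Unique.map⁺ suc-injective (Unique.upTo⁺ (length π)))

S-Unique : ∀ {π} → IsPerm π → Unique (S π)
S-Unique {π} π↭ = Unique-resp-↭ (↭⇒↭ₛ (↭-sym (S-↭ π))) (IsPerm⇒Unique π↭)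

IsPerm-at≤length : ∀ {π} → IsPerm π → ∀ {t} → InRange π t → at π t ≤ length π
IsPerm-at≤length {π} π↭ t∈ with ∈-map⁻ suc (∈-resp-↭ π↭ (at-∈ π t∈))
... | i , i∈upTo , eq with ∈-upTo⁻ i∈upTo
... | i<n = subst (_≤ length π) (sym eq) i<n

occ-fromValues : ∀ p π idx ws → length idx ≡ length p → Linked _<_ idx →
                 All (InRange π) idx → Linked _<_ ws → All (InRange ws) p →
                 map (at π) idx ≡ map (at ws) p → Occ p π idx
occ-fromValues p π idx ws |idx|≡|p| idx↗ idx∈π ws↗ p∈ws values =
  |idx|≡|p| ,
  (λ a 1≤a 1+a≤n → at-strictMono idx↗ 1≤a (n<1+n a) 1+a≤n) ,
  (λ a 1≤a a≤n → All-at idx∈π (1≤a , a≤n)) ,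
  (λ a b 1≤a a≤n 1≤b b≤n →
    subst₂ (λ u v → u < v ⇔ at p a < at p b)
           (sym (value (1≤a , a≤n))) (sym (value (1≤b , b≤n)))
           (at-<⇔ ws↗ (value∈ws (1≤a , a≤n)) (value∈ws (1≤b , b≤n))))
  where
  idx⇒p : ∀ {a} → InRange idx a → InRange p a
  idx⇒p (1≤a , a≤n) = 1≤a , subst (_ ≤_) |idx|≡|p| a≤n
  value : ∀ {a} → InRange idx a → at π (at idx a) ≡ at ws (at p a)
  value {a} a∈ = begin
    at π (at idx a)     ≡⟨ at-map (at π) idx a∈ ⟨
    at (map (at π) idx) a ≡⟨ cong (λ L → at L a) values ⟩
    at (map (at ws) p) a  ≡⟨ at-map (at ws) p (idx⇒p a∈) ⟩
    at ws (at p a)      ∎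
    where open ≡-Reasoning
  value∈ws : ∀ {a} → InRange idx a → InRange ws (at p a)
  value∈ws a∈ = All-at p∈ws (idx⇒p a∈)

-- The T-arguments below are discharged by evaluation at numerals, for patterns
-- and index lists of known length.
inRangeᵇ : ∀ {n} i → {T (1 ≤ᵇ i)} → {T (i ≤ᵇ n)} → 1 ≤ i × i ≤ n
inRangeᵇ i {1≤i} {i≤n} = ≤ᵇ⇒≤ 1 i 1≤i , ≤ᵇ⇒≤ i _ i≤n

occ-< : ∀ {p} π {idx} → Occ p π idx → ∀ a b →
        {T (1 ≤ᵇ a)} → {T (a ≤ᵇ length idx)} → {T (1 ≤ᵇ b)} → {T (b ≤ᵇ length idx)} →
        {T (at p a <ᵇ at p b)} → at π (at idx a) < at π (at idx b)
occ-< π (_ , _ , _ , order) a b {1≤a} {a≤n} {1≤b} {b≤n} {pa<pb} =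
  Equivalence.from (order a b (≤ᵇ⇒≤ 1 a 1≤a) (≤ᵇ⇒≤ a _ a≤n) (≤ᵇ⇒≤ 1 b 1≤b) (≤ᵇ⇒≤ b _ b≤n))
                   (<ᵇ⇒< _ _ pa<pb)

occ-pos< : ∀ {p} π {idx} → Occ p π idx → ∀ a b →
           {T (1 ≤ᵇ a)} → {T (a <ᵇ b)} → {T (b ≤ᵇ length idx)} → at idx a < at idx b
occ-pos< π {idx} (_ , step , _) a b {1≤a} {a<b} {b≤n} =
  steps⇒< (at idx) step (≤ᵇ⇒≤ 1 a 1≤a) (<ᵇ⇒< a b a<b) (≤ᵇ⇒≤ b _ b≤n)

occ-inRange : ∀ {p} π {idx} → Occ p π idx → ∀ a → {T (1 ≤ᵇ a)} → {T (a ≤ᵇ length idx)} →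
              InRange π (at idx a)
occ-inRange π (_ , _ , inRange , _) a {1≤a} {a≤n} = inRange a (≤ᵇ⇒≤ 1 a 1≤a) (≤ᵇ⇒≤ a _ a≤n)

↭-3241 : ∀ {a b c d : ℕ} → c ∷ b ∷ d ∷ a ∷ [] ↭ a ∷ b ∷ c ∷ d ∷ []
↭-3241 {a} {b} {c} {d} = begin
  c ∷ b ∷ d ∷ a ∷ [] ↭⟨ ↭-prep c (↭-prep b (↭-swap d a ↭-refl)) ⟩
  c ∷ b ∷ a ∷ d ∷ [] ↭⟨ ↭-prep c (↭-swap b a ↭-refl) ⟩
  c ∷ a ∷ b ∷ d ∷ [] ↭⟨ ↭-swap c a ↭-refl ⟩
  a ∷ c ∷ b ∷ d ∷ [] ↭⟨ ↭-prep a (↭-swap c b ↭-refl) ⟩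
  a ∷ b ∷ c ∷ d ∷ [] ∎
  where open PermutationReasoning

↗↭↗⇒≡ : ∀ {xs ys} → Linked _<_ xs → Linked _<_ ys → xs ↭ ys → xs ≡ ys
↗↭↗⇒≡ xs↗ ys↗ xs↭ys =
  ≋⇒≡ (↗↭↗⇒≋ ≤-totalOrder (Linked.map <⇒≤ xs↗) (Linked.map <⇒≤ ys↗) (↭⇒↭ₛ xs↭ys))

sorted-roles : ∀ {r₁ r₂ r₃ r₄ a b c d : ℕ} → r₁ < r₂ → r₂ < r₃ → r₃ < r₄ →
  a < b → b < c → c < d → r₁ ∷ r₂ ∷ r₃ ∷ r₄ ∷ [] ↭ c ∷ b ∷ d ∷ a ∷ [] →
  r₁ ≡ a × r₂ ≡ b × r₃ ≡ c × r₄ ≡ d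
sorted-roles {r₁} {r₂} {r₃} {r₄} {a} {b} {c} {d} r₁<r₂ r₂<r₃ r₃<r₄ a<b b<c c<d r↭ =
  entry 1 , entry 2 , entry 3 , entry 4
  where
  rs≡abcd : r₁ ∷ r₂ ∷ r₃ ∷ r₄ ∷ [] ≡ a ∷ b ∷ c ∷ d ∷ []
  rs≡abcd = ↗↭↗⇒≡ (r₁<r₂ ∷ r₂<r₃ ∷ r₃<r₄ ∷ [-]) (a<b ∷ b<c ∷ c<d ∷ [-]) (↭-trans r↭ ↭-3241)
  entry : ∀ i → at (r₁ ∷ r₂ ∷ r₃ ∷ r₄ ∷ []) i ≡ at (a ∷ b ∷ c ∷ d ∷ []) i
  entry i = cong (λ xs → at xs i) rs≡abcd

-- Mesh occurrences give 3241 in S π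

S3241With : List ℕ → List ℕ → Set
S3241With π roles = ∃[ idx′ ] (Occ p3241 (S π) idx′ × entries (S π) idx′ ↭ roles)

separations⇒S3241 : ∀ {π} → IsPerm π → ∀ {a b c d} → a < b → b < c → c < d →
  Separated π c b → ¬ Separated π d b → Separated π d a →
  S3241With π (a ∷ b ∷ c ∷ d ∷ [])
separations⇒S3241 {π} π↭ a<b b<c c<d sep-cb ¬sep-db sep-da
  with before⇒at (separated⇒before-S π b<c sep-cb)
     | before⇒at (separated⇒before-S π (<-trans a<b (<-trans b<c c<d)) sep-da)
... | i₁ , i₂ , 1≤i₁ , i₁<i₂ , i₂≤n , refl , refl | i₃ , i₄ , 1≤i₃ , i₃<i₄ , i₄≤n , refl , refl =
  (i₁ ∷ i₂ ∷ i₃ ∷ i₄ ∷ []) ,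
  occ-fromValues p3241 σ _ (at σ i₄ ∷ at σ i₂ ∷ at σ i₁ ∷ at σ i₃ ∷ []) refl
    (i₁<i₂ ∷ i₂<i₃ ∷ i₃<i₄ ∷ [-])
    ((1≤i₁ , <⇒≤ (<-≤-trans i₁<i₂ i₂≤n)) ∷ i₂∈ ∷ i₃∈ ∷ (<-≤-trans (s≤s z≤n) i₃<i₄ , i₄≤n) ∷ [])
    (a<b ∷ b<c ∷ c<d ∷ [-])
    (inRangeᵇ 3 ∷ inRangeᵇ 2 ∷ inRangeᵇ 4 ∷ inRangeᵇ 1 ∷ [])
    refl ,
  ↭-3241
  where
  σ : List ℕ
  σ = S π
  i₂∈ : InRange σ i₂
  i₂∈ = <-≤-trans (s≤s z≤n) i₁<i₂ , i₂≤n
  i₃∈ : InRange σ i₃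
  i₃∈ = 1≤i₃ , <⇒≤ (<-≤-trans i₃<i₄ i₄≤n)
  i₂<i₃ : i₂ < i₃
  i₂<i₃ = before⇒< (S-Unique π↭)
    (¬separated⇒before-S π (separated-∈ʳ sep-cb) (separated-∈ˡ sep-da) (<-trans b<c c<d) ¬sep-db)
    i₂∈ refl i₃∈ refl

-- Shading the boxes (a,4) and (a,5), with lo, hi the positions bounding column
-- a, v = v₄ and at π q = v₅, leaves nothing above v₄ in that column.
shaded-top-boxes : ∀ {π} → IsPerm π → ∀ {lo hi v q t} → InRange π q → InRange π t → t ≢ q →
  lo < t → t < hi →
  ¬ (1 ≤ t × t ≤ length π × lo < t × t < hi × v < at π t × at π t < at π q) →
  ¬ (1 ≤ t × t ≤ length π × lo < t × t < hi × at π q < at π t × at π t < suc (length π)) →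
  ¬ v < at π t
shaded-top-boxes {π} π↭ {q = q} {t} q∈ t∈@(1≤t , t≤n) t≢q lo<t t<hi ¬box₄ ¬box₅ v<πt
  with <-cmp (at π t) (at π q)
... | tri< πt<πq _ _ = ¬box₄ (1≤t , t≤n , lo<t , t<hi , v<πt , πt<πq)
... | tri≈ _ πt≡πq _ = t≢q (at-injective (IsPerm⇒Unique π↭) t∈ q∈ πt≡πq)
... | tri> _ _ πq<πt = ¬box₅ (1≤t , t≤n , lo<t , t<hi , πq<πt , s≤s (IsPerm-at≤length π↭ t∈))

j₁⇒S3241 : ∀ {π} → IsPerm π → ∀ {idx} → MeshOcc (j 0F) π idx →
            S3241With π (roles1234 (j 0F) π idx)
j₁⇒S3241 {π} π↭ {q₁ ∷ q₂ ∷ q₃ ∷ q₄ ∷ q₅ ∷ []} (O , [] , marked) =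
  separations⇒S3241 π↭ (occ-< π O 5 2) (occ-< π O 2 1) (occ-< π O 1 3) sep-cb ¬sep-db sep-da
  where
  sep-through : ∀ {t} → q₁ < t → t < q₂ → at π q₁ < at π t →
                Separated π (at π q₁) (at π q₂)
  sep-through q₁<t t<q₂ =
    at⇒separated π (occ-inRange π O 1) q₁<t t<q₂ (occ-inRange π O 2)
  sep-cb : Separated π (at π q₁) (at π q₂)
  sep-cb = case marked of λ where
    (here (t , _ , _ , q₁<t , t<q₂ , c<πt , _)) → sep-through q₁<t t<q₂ c<πt
    (there (here (t , _ , _ , q₁<t , t<q₂ , d<πt , _))) →
      sep-through q₁<t t<q₂ (<-trans (occ-< π O 1 3) d<πt)
    (there (there (here (t , _ , _ , q₁<t , t<q₂ , e<πt , _)))) →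
      sep-through q₁<t t<q₂ (<-trans (occ-< π O 1 4) e<πt)
  ¬sep-db : ¬ Separated π (at π q₃) (at π q₂)
  ¬sep-db s with separated⇒between (IsPerm⇒Unique π↭) (occ-inRange π O 3) (occ-inRange π O 2) s
  ... | _ , _ , q₃<k , k<q₂ , _ = <-asym (occ-pos< π O 2 3) (<-trans q₃<k k<q₂)
  sep-da : Separated π (at π q₃) (at π q₅)
  sep-da = at⇒separated π (occ-inRange π O 3) (occ-pos< π O 3 4) (occ-pos< π O 4 5)
                          (occ-inRange π O 5) (occ-< π O 3 4)

j₂⇒S3241 : ∀ {π} → IsPerm π → ∀ {idx} → MeshOcc (j 1F) π idx →
            S3241With π (roles1234 (j 1F) π idx)
j₂⇒S3241 {π} π↭ {q₁ ∷ q₂ ∷ q₃ ∷ q₄ ∷ q₅ ∷ []} (O , ¬box₂₄ ∷ ¬box₂₅ ∷ [] , _) =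
  separations⇒S3241 π↭ (occ-< π O 5 3) (occ-< π O 3 1) (occ-< π O 1 2) sep-cb ¬sep-db sep-da
  where
  sep-cb : Separated π (at π q₁) (at π q₃)
  sep-cb = at⇒separated π (occ-inRange π O 1) (occ-pos< π O 1 2) (occ-pos< π O 2 3)
                          (occ-inRange π O 3) (occ-< π O 1 2)
  ¬sep-db : ¬ Separated π (at π q₂) (at π q₃)
  ¬sep-db s with separated⇒between (IsPerm⇒Unique π↭) (occ-inRange π O 2) (occ-inRange π O 3) s
  ... | k , k∈ , q₂<k , k<q₃ , d<πk =
    shaded-top-boxes π↭ (occ-inRange π O 4) k∈ (λ { refl → <-asym k<q₃ (occ-pos< π O 3 4) })
                     q₂<k k<q₃ (¬box₂₄ k) (¬box₂₅ k) d<πk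
  sep-da : Separated π (at π q₂) (at π q₅)
  sep-da = at⇒separated π (occ-inRange π O 2) (occ-pos< π O 2 4) (occ-pos< π O 4 5)
                          (occ-inRange π O 5) (occ-< π O 2 4)

j₃⇒S3241 : ∀ {π} → IsPerm π → ∀ {idx} → MeshOcc (j 2F) π idx →
            S3241With π (roles1234 (j 2F) π idx)
j₃⇒S3241 {π} π↭ {q₁ ∷ q₂ ∷ q₃ ∷ q₄ ∷ q₅ ∷ []}
          (O , ¬box₁₄ ∷ ¬box₁₅ ∷ ¬box₂₄ ∷ ¬box₂₅ ∷ [] , here (t , _ , _ , q₂<t , t<q₃ , c<πt , _)) =
  separations⇒S3241 π↭ (occ-< π O 5 3) (occ-< π O 3 2) (occ-< π O 2 1) sep-cb ¬sep-db sep-da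
  where
  sep-cb : Separated π (at π q₂) (at π q₃)
  sep-cb = at⇒separated π (occ-inRange π O 2) q₂<t t<q₃ (occ-inRange π O 3) c<πt
  ¬sep-db : ¬ Separated π (at π q₁) (at π q₃)
  ¬sep-db s with separated⇒between (IsPerm⇒Unique π↭) (occ-inRange π O 1) (occ-inRange π O 3) s
  ... | k , k∈ , q₁<k , k<q₃ , d<πk with <-cmp k q₂
  ...   | tri< k<q₂ _ _ =
    shaded-top-boxes π↭ (occ-inRange π O 4) k∈ (λ { refl → <-asym k<q₃ (occ-pos< π O 3 4) })
                     q₁<k k<q₂ (¬box₁₄ k) (¬box₁₅ k) d<πk
  ...   | tri≈ _ refl _ = <-asym d<πk (occ-< π O 2 1)
  ...   | tri> _ _ q₂<k =
    shaded-top-boxes π↭ (occ-inRange π O 4) k∈ (λ { refl → <-asym k<q₃ (occ-pos< π O 3 4) })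
                     q₂<k k<q₃ (¬box₂₄ k) (¬box₂₅ k) d<πk
  sep-da : Separated π (at π q₁) (at π q₅)
  sep-da = at⇒separated π (occ-inRange π O 1) (occ-pos< π O 1 4) (occ-pos< π O 4 5)
                          (occ-inRange π O 5) (occ-< π O 1 4)

mesh⇒S3241 : ∀ {π} → IsPerm π → ∀ k {idx} → MeshOcc (j k) π idx →
             S3241With π (roles1234 (j k) π idx)
mesh⇒S3241 π↭ 0F = j₁⇒S3241 π↭
mesh⇒S3241 π↭ 1F = j₂⇒S3241 π↭
mesh⇒S3241 π↭ 2F = j₃⇒S3241 π↭

-- A 3241 in S π comes from exactly one mesh pattern

Layout : Fin 3 → (pc pb pd : ℕ) → Set
Layout 0F pc pb pd = pb < pd
Layout 1F pc pb pd = pc < pd × pd < pb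
Layout 2F pc pb pd = pd < pc

Layout-functional : ∀ {pc pb pd} → pc < pb → ∀ {k k′} →
                    Layout k pc pb pd → Layout k′ pc pb pd → k ≡ k′
Layout-functional _     {0F} {0F} _           _           = refl
Layout-functional _     {0F} {1F} pb<pd       (_ , pd<pb) = ⊥-elim (<-asym pb<pd pd<pb)
Layout-functional pc<pb {0F} {2F} pb<pd       pd<pc       = ⊥-elim (<-asym pc<pb (<-trans pb<pd pd<pc))
Layout-functional _     {1F} {0F} (_ , pd<pb) pb<pd       = ⊥-elim (<-asym pb<pd pd<pb)
Layout-functional _     {1F} {1F} _           _           = refl
Layout-functional _     {1F} {2F} (pc<pd , _) pd<pc       = ⊥-elim (<-asym pc<pd pd<pc)
Layout-functional pc<pb {2F} {0F} pd<pc       pb<pd       = ⊥-elim (<-asym pc<pb (<-trans pb<pd pd<pc))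
Layout-functional _     {2F} {1F} pd<pc       (pc<pd , _) = ⊥-elim (<-asym pc<pd pd<pc)
Layout-functional _     {2F} {2F} _           _           = refl

-- Positions in π of the values c > b and d > a of a 3241 (c, b, d, a) in S π,
-- with witnesses k₁, k₂ of the separations of c from b and of d from a.
record Config (π : List ℕ) : Set where
  field
    pc k₁ pb pd k₂ pa : ℕ
    1≤pc    : 1 ≤ pc
    pc<k₁   : pc < k₁
    k₁<pb   : k₁ < pb
    pb≤n    : pb ≤ length π
    c<πk₁   : at π pc < at π k₁
    1≤pd    : 1 ≤ pd
    pd<k₂   : pd < k₂
    k₂<pa   : k₂ < pa
    pa≤n    : pa ≤ length π
    d<πk₂   : at π pd < at π k₂
    a<b     : at π pa < at π pb
    b<c     : at π pb < at π pc
    c<d     : at π pc < at π pd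
    ¬sep-db : ¬ Separated π (at π pd) (at π pb)

MeshWith : List ℕ → Fin 3 → List ℕ → Set
MeshWith π k roles = ∃[ idx ] (MeshOcc (j k) π idx × roles1234 (j k) π idx ↭ roles)

module Classification {π} (π↭ : IsPerm π) (C : Config π) where
  open Config C

  u : Unique π
  u = IsPerm⇒Unique π↭

  pc<pb : pc < pb
  pc<pb = <-trans pc<k₁ k₁<pb

  pc∈ : InRange π pc
  pc∈ = 1≤pc , <⇒≤ (<-≤-trans pc<pb pb≤n)
  1≤k₁ : 1 ≤ k₁
  1≤k₁ = <-≤-trans (s≤s z≤n) pc<k₁
  k₁≤n : k₁ ≤ length π
  k₁≤n = <⇒≤ (<-≤-trans k₁<pb pb≤n)
  k₁∈ : InRange π k₁
  k₁∈ = 1≤k₁ , k₁≤n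
  pb∈ : InRange π pb
  pb∈ = <-≤-trans (s≤s z≤n) pc<pb , pb≤n
  pd∈ : InRange π pd
  pd∈ = 1≤pd , <⇒≤ (<-≤-trans (<-trans pd<k₂ k₂<pa) pa≤n)
  k₂∈ : InRange π k₂
  k₂∈ = <-≤-trans (s≤s z≤n) pd<k₂ , <⇒≤ (<-≤-trans k₂<pa pa≤n)
  pa∈ : InRange π pa
  pa∈ = <-≤-trans (s≤s z≤n) (<-trans pd<k₂ k₂<pa) , pa≤n

  nothing-above-d : ∀ {t} → pd < t → t < pb → ¬ at π pd < at π t
  nothing-above-d pd<t t<pb d<πt = ¬sep-db (at⇒separated π pd∈ pd<t t<pb pb∈ d<πt)

  pb<k₂ : pb < k₂
  pb<k₂ with <-cmp pb k₂
  ... | tri< pb<k₂ _ _ = pb<k₂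
  ... | tri≈ _ refl _  = ⊥-elim (<-asym (<-trans b<c c<d) d<πk₂)
  ... | tri> _ _ k₂<pb = ⊥-elim (nothing-above-d pd<k₂ k₂<pb d<πk₂)

  values↗ : Linked _<_ (at π pa ∷ at π pb ∷ at π pc ∷ at π pd ∷ at π k₂ ∷ [])
  values↗ = a<b ∷ b<c ∷ c<d ∷ d<πk₂ ∷ [-]

  Target : Fin 3 → Set
  Target k = MeshWith π k (at π pc ∷ at π pb ∷ at π pd ∷ at π pa ∷ [])

  j₁-from-layout : Layout 0F pc pb pd → Target 0F
  j₁-from-layout pb<pd = idx , (occ , [] , marked) , ↭-sym ↭-3241
    where
    idx : List ℕ
    idx = pc ∷ pb ∷ pd ∷ k₂ ∷ pa ∷ []
    occ : Occ (3 ∷ 2 ∷ 4 ∷ 5 ∷ 1 ∷ []) π idx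
    occ = occ-fromValues _ π idx _ refl (pc<pb ∷ pb<pd ∷ pd<k₂ ∷ k₂<pa ∷ [-])
            (pc∈ ∷ pb∈ ∷ pd∈ ∷ k₂∈ ∷ pa∈ ∷ []) values↗
            (inRangeᵇ 3 ∷ inRangeᵇ 2 ∷ inRangeᵇ 4 ∷ inRangeᵇ 5 ∷ inRangeᵇ 1 ∷ []) refl
    marked : MarkedOK (3 ∷ 2 ∷ 4 ∷ 5 ∷ 1 ∷ []) π idx ((1 , 3) ∷ (1 , 4) ∷ (1 , 5) ∷ [])
    marked with <-cmp (at π k₁) (at π pd)
    ... | tri< πk₁<d _ _ = here (k₁ , 1≤k₁ , k₁≤n , pc<k₁ , k₁<pb , c<πk₁ , πk₁<d)
    ... | tri≈ _ πk₁≡d _ =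
      ⊥-elim (<-irrefl (at-injective u k₁∈ pd∈ πk₁≡d) (<-trans k₁<pb pb<pd))
    ... | tri> _ _ d<πk₁ with <-cmp (at π k₁) (at π k₂)
    ...   | tri< πk₁<e _ _ = there (here (k₁ , 1≤k₁ , k₁≤n , pc<k₁ , k₁<pb , d<πk₁ , πk₁<e))
    ...   | tri≈ _ πk₁≡e _ =
      ⊥-elim (<-irrefl (at-injective u k₁∈ k₂∈ πk₁≡e) (<-trans k₁<pb pb<k₂))
    ...   | tri> _ _ e<πk₁ =
      there (there (here (k₁ , 1≤k₁ , k₁≤n , pc<k₁ , k₁<pb , e<πk₁ ,
                          s≤s (IsPerm-at≤length π↭ k₁∈))))

  j₂-from-layout : Layout 1F pc pb pd → Target 1F
  j₂-from-layout (pc<pd , pd<pb) = idx , (occ , shaded , _) , ↭-sym ↭-3241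
    where
    idx : List ℕ
    idx = pc ∷ pd ∷ pb ∷ k₂ ∷ pa ∷ []
    occ : Occ (3 ∷ 4 ∷ 2 ∷ 5 ∷ 1 ∷ []) π idx
    occ = occ-fromValues _ π idx _ refl (pc<pd ∷ pd<pb ∷ pb<k₂ ∷ k₂<pa ∷ [-])
            (pc∈ ∷ pd∈ ∷ pb∈ ∷ k₂∈ ∷ pa∈ ∷ []) values↗
            (inRangeᵇ 3 ∷ inRangeᵇ 4 ∷ inRangeᵇ 2 ∷ inRangeᵇ 5 ∷ inRangeᵇ 1 ∷ []) refl
    shaded : All (λ box → ∀ t → ¬ InBox (3 ∷ 4 ∷ 2 ∷ 5 ∷ 1 ∷ []) π idx box t)
                 ((2 , 4) ∷ (2 , 5) ∷ [])
    shaded = (λ { t (_ , _ , pd<t , t<pb , d<πt , _) →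
                  nothing-above-d pd<t t<pb d<πt })
           ∷ (λ { t (_ , _ , pd<t , t<pb , e<πt , _) →
                  nothing-above-d pd<t t<pb (<-trans d<πk₂ e<πt) })
           ∷ []

  j₃-from-layout : Layout 2F pc pb pd → Target 2F
  j₃-from-layout pd<pc = idx , (occ , shaded , marked) , ↭-sym ↭-3241
    where
    idx : List ℕ
    idx = pd ∷ pc ∷ pb ∷ k₂ ∷ pa ∷ []
    occ : Occ (4 ∷ 3 ∷ 2 ∷ 5 ∷ 1 ∷ []) π idx
    occ = occ-fromValues _ π idx _ refl (pd<pc ∷ pc<pb ∷ pb<k₂ ∷ k₂<pa ∷ [-])
            (pd∈ ∷ pc∈ ∷ pb∈ ∷ k₂∈ ∷ pa∈ ∷ []) values↗
            (inRangeᵇ 4 ∷ inRangeᵇ 3 ∷ inRangeᵇ 2 ∷ inRangeᵇ 5 ∷ inRangeᵇ 1 ∷ []) refl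
    shaded : All (λ box → ∀ t → ¬ InBox (4 ∷ 3 ∷ 2 ∷ 5 ∷ 1 ∷ []) π idx box t)
                 ((1 , 4) ∷ (1 , 5) ∷ (2 , 4) ∷ (2 , 5) ∷ [])
    shaded = (λ { t (_ , _ , pd<t , t<pc , d<πt , _) →
                  nothing-above-d pd<t (<-trans t<pc pc<pb) d<πt })
           ∷ (λ { t (_ , _ , pd<t , t<pc , e<πt , _) →
                  nothing-above-d pd<t (<-trans t<pc pc<pb) (<-trans d<πk₂ e<πt) })
           ∷ (λ { t (_ , _ , pc<t , t<pb , d<πt , _) →
                  nothing-above-d (<-trans pd<pc pc<t) t<pb d<πt })
           ∷ (λ { t (_ , _ , pc<t , t<pb , e<πt , _) →
                  nothing-above-d (<-trans pd<pc pc<t) t<pb (<-trans d<πk₂ e<πt) })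
           ∷ []
    marked : MarkedOK (4 ∷ 3 ∷ 2 ∷ 5 ∷ 1 ∷ []) π idx ((2 , 3) ∷ [])
    marked with <-cmp (at π k₁) (at π pd)
    ... | tri< πk₁<d _ _ = here (k₁ , 1≤k₁ , k₁≤n , pc<k₁ , k₁<pb , c<πk₁ , πk₁<d)
    ... | tri≈ _ πk₁≡d _ =
      ⊥-elim (<-irrefl (at-injective u pd∈ k₁∈ (sym πk₁≡d)) (<-trans pd<pc pc<k₁))
    ... | tri> _ _ d<πk₁ = ⊥-elim (nothing-above-d (<-trans pd<pc pc<k₁) k₁<pb d<πk₁)

  position : ∀ {q p} → InRange π q → InRange π p → at π q ≡ at π p → q ≡ p
  position = at-injective u

  layout-of : ∀ k → Target k → Layout k pc pb pd
  layout-of 0F (q₁ ∷ q₂ ∷ q₃ ∷ q₄ ∷ q₅ ∷ [] , (O , _) , roles↭) =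
    let _ , πq₂≡b , _ , πq₃≡d =
          sorted-roles (occ-< π O 5 2) (occ-< π O 2 1) (occ-< π O 1 3) a<b b<c c<d roles↭
    in subst₂ _<_ (position (occ-inRange π O 2) pb∈ πq₂≡b) (position (occ-inRange π O 3) pd∈ πq₃≡d)
              (occ-pos< π O 2 3)
  layout-of 1F (q₁ ∷ q₂ ∷ q₃ ∷ q₄ ∷ q₅ ∷ [] , (O , _) , roles↭) =
    let _ , πq₃≡b , πq₁≡c , πq₂≡d =
          sorted-roles (occ-< π O 5 3) (occ-< π O 3 1) (occ-< π O 1 2) a<b b<c c<d roles↭
        q₂≡pd = position (occ-inRange π O 2) pd∈ πq₂≡d
    in subst₂ _<_ (position (occ-inRange π O 1) pc∈ πq₁≡c) q₂≡pd (occ-pos< π O 1 2) ,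
       subst₂ _<_ q₂≡pd (position (occ-inRange π O 3) pb∈ πq₃≡b) (occ-pos< π O 2 3)
  layout-of 2F (q₁ ∷ q₂ ∷ q₃ ∷ q₄ ∷ q₅ ∷ [] , (O , _) , roles↭) =
    let _ , _ , πq₂≡c , πq₁≡d =
          sorted-roles (occ-< π O 5 3) (occ-< π O 3 2) (occ-< π O 2 1) a<b b<c c<d roles↭
    in subst₂ _<_ (position (occ-inRange π O 1) pd∈ πq₁≡d) (position (occ-inRange π O 2) pc∈ πq₂≡c)
              (occ-pos< π O 1 2)

  some-layout : ∃[ k ] Layout k pc pb pd
  some-layout with <-cmp pd pc | <-cmp pd pb
  ... | tri< pd<pc _ _ | _              = 2F , pd<pc
  ... | tri≈ _ refl _  | _              = ⊥-elim (<-irrefl refl c<d)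
  ... | tri> _ _ pc<pd | tri< pd<pb _ _ = 1F , pc<pd , pd<pb
  ... | tri> _ _ _     | tri≈ _ refl _  = ⊥-elim (<-irrefl refl (<-trans b<c c<d))
  ... | tri> _ _ _     | tri> _ _ pb<pd = 0F , pb<pd

  from-layout : ∀ k → Layout k pc pb pd → Target k
  from-layout 0F = j₁-from-layout
  from-layout 1F = j₂-from-layout
  from-layout 2F = j₃-from-layout

  unique-mesh : ∃! _≡_ Target
  unique-mesh with some-layout
  ... | k , layout = k , from-layout k layout ,
                     λ {k′} target → Layout-functional pc<pb layout (layout-of k′ target)

separations⇒unique-mesh : ∀ {π} → IsPerm π → ∀ {a b c d} → a < b → b < c → c < d →
  Separated π c b → ¬ Separated π d b → Separated π d a →
  ∃! _≡_ (λ k → MeshWith π k (c ∷ b ∷ d ∷ a ∷ []))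
separations⇒unique-mesh π↭ a<b b<c c<d sep-cb ¬sep-db sep-da
  with separated⇒at sep-cb | separated⇒at sep-da
... | pc , k₁ , pb , 1≤pc , pc<k₁ , k₁<pb , pb≤n , refl , c<πk₁ , refl
    | pd , k₂ , pa , 1≤pd , pd<k₂ , k₂<pa , pa≤n , refl , d<πk₂ , refl =
  Classification.unique-mesh π↭ record
    { pc = pc ; k₁ = k₁ ; pb = pb ; pd = pd ; k₂ = k₂ ; pa = pa
    ; 1≤pc = 1≤pc ; pc<k₁ = pc<k₁ ; k₁<pb = k₁<pb ; pb≤n = pb≤n ; c<πk₁ = c<πk₁
    ; 1≤pd = 1≤pd ; pd<k₂ = pd<k₂ ; k₂<pa = k₂<pa ; pa≤n = pa≤n ; d<πk₂ = d<πk₂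
    ; a<b = a<b ; b<c = b<c ; c<d = c<d ; ¬sep-db = ¬sep-db }

S3241⇒unique-mesh : ∀ {π} → IsPerm π → ∀ idx′ → Occ p3241 (S π) idx′ →
                     ∃! _≡_ (λ k → MeshWith π k (entries (S π) idx′))
S3241⇒unique-mesh {π} π↭ (i₁ ∷ i₂ ∷ i₃ ∷ i₄ ∷ []) O =
  separations⇒unique-mesh π↭ a<b b<c c<d
    (before-S⇒separated π b<c cb)
    (λ sep-db → before-asym (S-Unique π↭) bd (separated⇒before-S π (<-trans b<c c<d) sep-db))
    (before-S⇒separated π (<-trans a<b (<-trans b<c c<d)) da)
  where
  σ : List ℕ
  σ = S π
  a<b : at σ i₄ < at σ i₂
  a<b = occ-< σ O 4 2
  b<c : at σ i₂ < at σ i₁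
  b<c = occ-< σ O 2 1
  c<d : at σ i₁ < at σ i₃
  c<d = occ-< σ O 1 3
  cb : Before σ (at σ i₁) (at σ i₂)
  cb = at⇒before σ (occ-inRange σ O 1) (occ-pos< σ O 1 2) (occ-inRange σ O 2)
  bd : Before σ (at σ i₂) (at σ i₃)
  bd = at⇒before σ (occ-inRange σ O 2) (occ-pos< σ O 2 3) (occ-inRange σ O 3)
  da : Before σ (at σ i₃) (at σ i₄)
  da = at⇒before σ (occ-inRange σ O 3) (occ-pos< σ O 3 4) (occ-inRange σ O 4)

lemma3p2 : (π : List ℕ) → IsPerm π →
    ((k : Fin 3) (idx : List ℕ) → MeshOcc (j k) π idx →
      ∃[ idx′ ] (Occ p3241 (S π) idx′ × entries (S π) idx′ ↭ roles1234 (j k) π idx))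
    × ((idx′ : List ℕ) → Occ p3241 (S π) idx′ →
      ∃! _≡_ (λ (k : Fin 3) → ∃[ idx ] (MeshOcc (j k) π idx
        × roles1234 (j k) π idx ↭ entries (S π) idx′)))
lemma3p2 π π↭ = (λ k idx → mesh⇒S3241 π↭ k) , S3241⇒unique-mesh π↭
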